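{- Let $m,n$ be positive integers, $e_1,\dots,e_m,f_1,\dots,f_n$ the standard basis of $\mathbb R^{m+n}$, and $\Delta(m,n)=\{(i|j):=e_i-f_j\}$. For nonempty $A\subseteq\{1,\dots,m\}$, $B\subseteq\{1,\dots,n\}$ let $A\times B=\{(i|j):i\in A,j\in B\}$, called degenerate if $|A|=1$ or $|B|=1$. Call $S\subseteq\Delta(m,n)$ complete if $\mathrm{span}(S)\cap\Delta(m,n)=S$, and a complete $S$ irreducible if there is no partition $S=S_1\sqcup S_2$ into nonempty sets with $\mathrm{span}(S)=\mathrm{span}(S_1)\oplus\mathrm{span}(S_2)$. Then every non-degenerate rectangle is irreducible. Moreover, if $S=\bigcup_{i=1}^h A_i\times B_i$ with the $A_i$ mutually disjoint and the $B_i$ mutually disjoint, then the irreducible components of $S$ (the unique family of irreducible subsets partitioning $S$ whose spans form a direct sum equal to $\mathrm{span}(S)$) are the non-degenerate rectangles $A_i\times B_i$ together with the single elements (as one-element sets) of the degenerate rectangles $A_i\times B_i$.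
   Formalization: The ambient space is ℚ^(m+n) rather than $\mathbb R^{m+n}$, so all spans and direct sums are taken with rational coefficients. -}

module Defs where

open import Data.Nat using (ℕ; _+_; _≤_)
import Data.Nat as ℕ
open import Data.Bool using (Bool; true; false; if_then_else_; _∨_; _∧_)
open import Data.Fin using (Fin; _↑ˡ_; _↑ʳ_)
import Data.Fin as F
open import Data.Fin.Subset using (Subset; _∈_; ∣_∣)
open import Data.Vec using (lookup)
open import Data.Rational using (ℚ; 0ℚ; 1ℚ; _-_)
import Data.Rational as Q
open import Data.Product using (Σ; ∃; _×_; _,_; proj₁; proj₂)
open import Data.Sum using (_⊎_)
open import Data.Unit using (⊤; tt)
open import Data.Empty using (⊥)
open import Data.List using (List; []; _∷_)
open import Data.List.Relation.Unary.All using (All)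
open import Relation.Binary.PropositionalEquality using (_≡_; _≢_)
open import Relation.Nullary using (¬_)
open import Relation.Nullary.Decidable using (⌊_⌋)

_⇔'_ : Set → Set → Set
P ⇔' Q = (P → Q) × (Q → P)

Vect : ℕ → Set
Vect d = Fin d → ℚ

0ᵥ : ∀ {d} → Vect d
0ᵥ _ = 0ℚ

_+ᵥ_ : ∀ {d} → Vect d → Vect d → Vect d
(u +ᵥ v) k = u k Q.+ v k

_·ᵥ_ : ∀ {d} → ℚ → Vect d → Vect d
(c ·ᵥ v) k = c Q.* v k

_≈ᵥ_ : ∀ {d} → Vect d → Vect d → Set
u ≈ᵥ v = ∀ k → u k ≡ v k

basis : ∀ {d} → Fin d → Vect d
basis a k = if ⌊ a F.≟ k ⌋ then 1ℚ else 0ℚ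

-- The root system Δ(m,n) in ℚ^(m+n): e_i = basis (i ↑ˡ n), f_j = basis (m ↑ʳ j)

Root : ℕ → ℕ → Set
Root m n = Fin m × Fin n

rootVec : ∀ {m n} → Root m n → Vect (m + n)
rootVec {m} {n} (i , j) k = basis (i ↑ˡ n) k - basis (m ↑ʳ j) k

RootSet : ℕ → ℕ → Set₁
RootSet m n = Root m n → Set

lincomb : ∀ {m n} → List (ℚ × Root m n) → Vect (m + n)
lincomb [] = 0ᵥ
lincomb ((c , r) ∷ l) = (c ·ᵥ rootVec r) +ᵥ lincomb l

Span : ∀ {m n} → RootSet m n → Vect (m + n) → Set
Span S v = Σ (List (ℚ × Root _ _)) λ l → All (λ p → S (proj₂ p)) l × (v ≈ᵥ lincomb l)

Complete : ∀ {m n} → RootSet m n → Set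
Complete S = ∀ r → Span S (rootVec r) ⇔' S r

DirectSum₂ : ∀ {d} → (Vect d → Set) → (Vect d → Set) → (Vect d → Set) → Set
DirectSum₂ U W₁ W₂ =
  (∀ v → U v ⇔' (Σ _ λ v₁ → Σ _ λ v₂ → W₁ v₁ × W₂ v₂ × (v ≈ᵥ (v₁ +ᵥ v₂))))
  × (∀ v → W₁ v → W₂ v → v ≈ᵥ 0ᵥ)

Irreducible : ∀ {m n} → RootSet m n → Set₁
Irreducible {m} {n} S =
  Complete S ×
  ¬ (Σ (RootSet m n) λ S₁ → Σ (RootSet m n) λ S₂ →
       (∀ r → S r ⇔' (S₁ r ⊎ S₂ r)) ×
       (∀ r → S₁ r → S₂ r → ⊥) ×
       (∃ S₁) × (∃ S₂) ×
       DirectSum₂ (Span S) (Span S₁) (Span S₂))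

Rect : ∀ {m n} → Subset m → Subset n → RootSet m n
Rect A B (i , j) = (i ∈ A) × (j ∈ B)

Degenerate : ∀ {m n} → Subset m → Subset n → Set
Degenerate A B = (∣ A ∣ ≡ 1) ⊎ (∣ B ∣ ≡ 1)

-- boolean version of Degenerate (used only to index the components)
isDeg : ∀ {m n} → Subset m → Subset n → Bool
isDeg A B = ⌊ ∣ A ∣ ℕ.≟ 1 ⌋ ∨ ⌊ ∣ B ∣ ℕ.≟ 1 ⌋

inRectᵇ : ∀ {m n} → Subset m → Subset n → Root m n → Bool
inRectᵇ A B (i , j) = lookup A i ∧ lookup B j

SumOver : ∀ {m n} {I : Set} → (I → RootSet m n) → (I → Set) → Vect (m + n) → Set
SumOver {m} {n} {I} C P v =
  Σ (List (I × Vect (m + n))) λ l →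
    All (λ p → P (proj₁ p) × Span (C (proj₁ p)) (proj₂ p)) l × (v ≈ᵥ sumᵥ l)
  where
  sumᵥ : List (I × Vect (m + n)) → Vect (m + n)
  sumᵥ [] = 0ᵥ
  sumᵥ ((_ , w) ∷ l) = w +ᵥ sumᵥ l

IsIrreducibleDecomposition : ∀ {m n} (I : Set) → (I → RootSet m n) → RootSet m n → Set₁
IsIrreducibleDecomposition I C S =
  (∀ t → ∃ (C t)) ×
  (∀ t r → C t r → S r) ×
  (∀ r → S r → ∃ λ t → C t r) ×
  (∀ s t r → C s r → C t r → s ≡ t) ×
  (∀ t → Irreducible (C t)) ×
  (∀ v → Span S v ⇔' SumOver C (λ _ → ⊤) v) ×
  (∀ t v → Span (C t) v → SumOver C (λ s → s ≢ t) v → v ≈ᵥ 0ᵥ)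

-- The family of Theorem: for S = ⋃ Aᵢ × Bᵢ, index i with a non-degenerate
-- rectangle contributes the single component Aᵢ × Bᵢ; a degenerate one
-- contributes one singleton component {r} per element r of Aᵢ × Bᵢ.

module Family {m n h : ℕ} (A : Fin h → Subset m) (B : Fin h → Subset n) where

  Union : RootSet m n
  Union r = ∃ λ i → Rect (A i) (B i) r

  IdxAt : Fin h → Bool → Set
  IdxAt i true  = Σ (Root m n) λ r → inRectᵇ (A i) (B i) r ≡ true
  IdxAt i false = ⊤

  CompIdx : Set
  CompIdx = Σ (Fin h) λ i → IdxAt i (isDeg (A i) (B i))

  compAt : (i : Fin h) → (b : Bool) → IdxAt i b → RootSet m n
  compAt i true  (r , _) = λ r′ → r′ ≡ r
  compAt i false _       = Rect (A i) (B i)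

  Comp : CompIdx → RootSet m n
  Comp (i , x) = compAt i (isDeg (A i) (B i)) x

{-# OPTIONS --safe #-}
-- The roots satisfy (a|c) + (b|d) = (a|d) + (b|c).  Suppose a rectangle with rows a ≠ b and
-- columns c, d is split as S₁ ⊔ S₂ with span S₁ ∩ span S₂ = 0, with (a|c) ∈ S₁ and (a|d) ∈ S₂.
-- Comparing the span S₁-components of the two sides of the identity at the coordinate e_a gives
-- 1 = 0: on the left only (a|c) touches e_a, on the right only (a|d), which lies in S₂.  Hence every
-- row, and likewise every column, of a non-degenerate rectangle lies on one side, so one side is empty.
--
-- For S = ⋃ Aᵢ × Bᵢ with disjoint Aᵢ and disjoint Bᵢ, every coordinate e_a or f_b is touched by the
-- roots of one rectangle only, so the span of a non-degenerate rectangle meets the sum of the other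
-- components only in vectors vanishing at every coordinate.  In a degenerate rectangle with a single
-- row, a root (a|b) is the only root of S touching f_b, which separates its multiples from the rest
-- (symmetrically for a single column).
module Submission where

open import Defs
open import Data.Nat using (ℕ; _≤_; s≤s; z≤n)
import Data.Nat as ℕ
open import Data.Nat.Properties using (≤-trans; ≤-antisym)
open import Data.Fin using (Fin; _↑ˡ_; _↑ʳ_; splitAt)
import Data.Fin as F
open import Data.Fin.Properties
  using (↑ˡ-injective; ↑ʳ-injective; splitAt-↑ˡ; splitAt-↑ʳ; splitAt⁻¹-↑ˡ; splitAt⁻¹-↑ʳ; any?)
open import Data.Fin.Subset using (Subset; Nonempty; _∩_; ⊥; _∈_; ∣_∣; ⁅_⁆)
open import Data.Fin.Subset.Properties
  using (_∈?_; ∉⊥; x∈p∩q⁺; x∈⁅x⁆; ∣⁅x⁆∣≡1; p⊆q⇒∣p∣≤∣q∣; x∈p⇒∣p-x∣<∣p∣; x∈p∧x≢y⇒x∈p-y)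
open import Data.Rational using (ℚ; 0ℚ; 1ℚ; _+_; _*_; -_)
open import Data.Rational.Properties
  using (+-identityʳ; +-identityˡ; +-assoc; +-comm; *-assoc; *-identityʳ; *-identityˡ; *-zeroʳ; *-zeroˡ; *-distribˡ-+; *-distribʳ-+)
open import Data.Rational.Solver using (module +-*-Solver)
open import Data.Product using (Σ; ∃; ∃-syntax; _×_; _,_; proj₁; proj₂)
open import Data.Sum using (_⊎_; inj₁; inj₂; [_,_])
open import Data.Empty using () renaming (⊥ to ⊥′)
open import Data.Unit using (⊤; tt)
open import Data.Bool using (true; false; _∨_) renaming (_≟_ to _≟ᵇ_)
open import Data.Vec using (lookup)
open import Data.Vec.Properties using (lookup⇒[]=; []=⇒lookup)
open import Axiom.UniquenessOfIdentityProofs using (module Decidable⇒UIP)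
open import Data.List using (List; []; _∷_; _++_; map)
open import Data.List.Relation.Unary.All as All using (All; []; _∷_)
open import Data.List.Relation.Unary.All.Properties using (++⁺; map⁺)
open import Function using (_∘_)
open import Relation.Binary.PropositionalEquality
  using (_≡_; _≢_; refl; sym; trans; cong; cong₂; subst; module ≡-Reasoning)
open import Relation.Nullary using (¬_; Dec; yes; no; contradiction; isYes)
open import Relation.Nullary.Decidable using (_×-dec_; ¬?)

private variable
  m n : ℕ

1ℚ≢0ℚ : 1ℚ ≢ 0ℚ
1ℚ≢0ℚ ()

-1ℚ≢0ℚ : - 1ℚ ≢ 0ℚ
-1ℚ≢0ℚ ()

p*u≡0⇒p≡0 : ∀ {p u} → u * u ≡ 1ℚ → p * u ≡ 0ℚ → p ≡ 0ℚ
p*u≡0⇒p≡0 {p} {u} u*u≡1 p*u≡0 = begin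
  p            ≡⟨ sym (*-identityʳ p) ⟩
  p * 1ℚ       ≡⟨ cong (p *_) (sym u*u≡1) ⟩
  p * (u * u)  ≡⟨ sym (*-assoc p u u) ⟩
  (p * u) * u  ≡⟨ cong (_* u) p*u≡0 ⟩
  0ℚ * u       ≡⟨ *-zeroˡ u ⟩
  0ℚ           ∎
  where open ≡-Reasoning

x∈p⇒0<∣p∣ : ∀ {p : Subset n} {x} → x ∈ p → 0 ℕ.< ∣ p ∣
x∈p⇒0<∣p∣ x∈p = ≤-trans (s≤s z≤n) (x∈p⇒∣p-x∣<∣p∣ x∈p)

module _ {p : Subset n} where

  ∣p∣≡1⇒unique : ∣ p ∣ ≡ 1 → ∀ {x y} → x ∈ p → y ∈ p → x ≡ y
  ∣p∣≡1⇒unique ∣p∣≡1 {x} {y} x∈p y∈p with y F.≟ x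
  ... | yes y≡x = sym y≡x
  ... | no y≢x
    with s≤s () ← subst (2 ℕ.≤_) ∣p∣≡1 (≤-trans (s≤s (x∈p⇒0<∣p∣ (x∈p∧x≢y⇒x∈p-y y∈p y≢x)))
                                                (x∈p⇒∣p-x∣<∣p∣ x∈p))

  ∣p∣≢1⇒another : ∣ p ∣ ≢ 1 → ∀ {x} → x ∈ p → ∃[ y ] y ∈ p × x ≢ y
  ∣p∣≢1⇒another ∣p∣≢1 {x} x∈p with any? (λ y → (y ∈? p) ×-dec ¬? (x F.≟ y))
  ... | yes found = found
  ... | no none   = contradiction (≤-antisym ∣p∣≤1 (x∈p⇒0<∣p∣ x∈p)) ∣p∣≢1
    where
    p⊆⁅x⁆ : ∀ {y} → y ∈ p → y ∈ ⁅ x ⁆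
    p⊆⁅x⁆ {y} y∈p with x F.≟ y
    ... | yes refl = x∈⁅x⁆ x
    ... | no x≢y   = contradiction (y , y∈p , x≢y) none
    ∣p∣≤1 : ∣ p ∣ ≤ 1
    ∣p∣≤1 = subst (∣ p ∣ ≤_) (∣⁅x⁆∣≡1 x) (p⊆q⇒∣p∣≤∣q∣ p⊆⁅x⁆)

disjoint⇒index-unique : ∀ {h} {P : Fin h → Subset n} → (∀ i j → i ≢ j → P i ∩ P j ≡ ⊥) →
                        ∀ {x i j} → x ∈ P i → x ∈ P j → i ≡ j
disjoint⇒index-unique disjoint {x} {i} {j} x∈Pi x∈Pj with i F.≟ j
... | yes i≡j = i≡j
... | no i≢j  = contradiction (subst (x ∈_) (disjoint i j i≢j) (x∈p∩q⁺ (x∈Pi , x∈Pj))) ∉⊥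

basis-diag : ∀ {d} (a : Fin d) → basis a a ≡ 1ℚ
basis-diag a with a F.≟ a
... | yes _   = refl
... | no a≢a = contradiction refl a≢a

basis-offdiag : ∀ {d} {a k : Fin d} → a ≢ k → basis a k ≡ 0ℚ
basis-offdiag {a = a} {k} a≢k with a F.≟ k
... | yes a≡k = contradiction a≡k a≢k
... | no _    = refl

↑ˡ≢↑ʳ : (i : Fin m) (j : Fin n) → i ↑ˡ n ≢ m ↑ʳ j
↑ˡ≢↑ʳ {m} {n} i j eq
  with () ← trans (sym (splitAt-↑ˡ m i n)) (trans (cong (splitAt m) eq) (splitAt-↑ʳ m n j))

module _ {i : Fin m} {j : Fin n} where

  rootVec-row-same : rootVec (i , j) (i ↑ˡ n) ≡ 1ℚ
  rootVec-row-same rewrite basis-diag (i ↑ˡ n) | basis-offdiag (↑ˡ≢↑ʳ i j ∘ sym) = refl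

  rootVec-col-same : rootVec (i , j) (m ↑ʳ j) ≡ - 1ℚ
  rootVec-col-same rewrite basis-diag (m ↑ʳ j) | basis-offdiag (↑ˡ≢↑ʳ i j) = refl

  rootVec-row-other : ∀ {i′} → i ≢ i′ → rootVec (i , j) (i′ ↑ˡ n) ≡ 0ℚ
  rootVec-row-other {i′} i≢i′
    rewrite basis-offdiag (i≢i′ ∘ ↑ˡ-injective n i i′) | basis-offdiag (↑ˡ≢↑ʳ i′ j ∘ sym)
    = refl

  rootVec-col-other : ∀ {j′} → j ≢ j′ → rootVec (i , j) (m ↑ʳ j′) ≡ 0ℚ
  rootVec-col-other {j′} j≢j′
    rewrite basis-offdiag (↑ˡ≢↑ʳ i j′) | basis-offdiag (j≢j′ ∘ ↑ʳ-injective m j j′) = refl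

rootVec-square : (a b : Fin m) (c d : Fin n) →
                 (rootVec (a , c) +ᵥ rootVec (b , d)) ≈ᵥ (rootVec (a , d) +ᵥ rootVec (b , c))
rootVec-square {m} {n} a b c d k =
  solve 4 (λ ea eb fc fd → (ea :- fc) :+ (eb :- fd) := (ea :- fd) :+ (eb :- fc)) refl
          (basis (a ↑ˡ n) k) (basis (b ↑ˡ n) k) (basis (m ↑ʳ c) k) (basis (m ↑ʳ d) k)
  where open +-*-Solver

data Coordinate (m n : ℕ) : Fin (m ℕ.+ n) → Set where
  row : (i : Fin m) → Coordinate m n (i ↑ˡ n)
  col : (j : Fin n) → Coordinate m n (m ↑ʳ j)

coordinate : (k : Fin (m ℕ.+ n)) → Coordinate m n k
coordinate {m} k with splitAt m k in eq
... | inj₁ i = subst (Coordinate _ _) (splitAt⁻¹-↑ˡ eq) (row i)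
... | inj₂ j = subst (Coordinate _ _) (splitAt⁻¹-↑ʳ eq) (col j)

module _ {S : RootSet m n} where

  span-resp : ∀ {u v} → u ≈ᵥ v → Span S v → Span S u
  span-resp u≈v (l , l⊆S , v≈l) = l , l⊆S , λ k → trans (u≈v k) (v≈l k)

  span-0ᵥ : Span S 0ᵥ
  span-0ᵥ = [] , [] , λ _ → refl

  span-root : ∀ r → S r → Span S (rootVec r)
  span-root r r∈S = (1ℚ , r) ∷ [] , r∈S ∷ [] , λ k → sym (trans (+-identityʳ _) (*-identityˡ (rootVec r k)))

  lincomb-++ : ∀ (l₁ l₂ : List (ℚ × Root m n)) k →
               lincomb (l₁ ++ l₂) k ≡ lincomb l₁ k + lincomb l₂ k
  lincomb-++ []             l₂ k = sym (+-identityˡ _)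
  lincomb-++ ((c , r) ∷ l₁) l₂ k rewrite lincomb-++ l₁ l₂ k = sym (+-assoc (c * rootVec r k) _ _)

  span-+ᵥ : ∀ {u v} → Span S u → Span S v → Span S (u +ᵥ v)
  span-+ᵥ (l₁ , l₁⊆S , u≈l₁) (l₂ , l₂⊆S , v≈l₂) =
    l₁ ++ l₂ , ++⁺ l₁⊆S l₂⊆S ,
    λ k → trans (cong₂ _+_ (u≈l₁ k) (v≈l₂ k)) (sym (lincomb-++ l₁ l₂ k))

  lincomb-scale : ∀ c (l : List (ℚ × Root m n)) k →
                  lincomb (map (λ (c′ , r) → (c * c′ , r)) l) k ≡ c * lincomb l k
  lincomb-scale c []             k = sym (*-zeroʳ c)
  lincomb-scale c ((c′ , r) ∷ l) k rewrite lincomb-scale c l k =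
    trans (cong (_+ c * lincomb l k) (*-assoc c c′ (rootVec r k))) (sym (*-distribˡ-+ c _ _))

  span-·ᵥ : ∀ c {v} → Span S v → Span S (c ·ᵥ v)
  span-·ᵥ c (l , l⊆S , v≈l) =
    map _ l , map⁺ l⊆S , λ k → trans (cong (c *_) (v≈l k)) (sym (lincomb-scale c l k))

span-mono : ∀ {S T : RootSet m n} → (∀ r → S r → T r) → ∀ {v} → Span S v → Span T v
span-mono S⊆T (l , l⊆S , v≈l) = l , All.map (S⊆T _) l⊆S , v≈l

lincomb-point : ∀ {r₀ : Root m n} l → All (λ p → proj₂ p ≡ r₀) l →
                ∃ λ c → lincomb l ≈ᵥ (c ·ᵥ rootVec r₀)
lincomb-point {r₀ = r₀} []             []             = 0ℚ , λ k → sym (*-zeroˡ (rootVec r₀ k))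
lincomb-point {r₀ = r₀} ((c , _) ∷ l) (refl ∷ l⊆r₀) =
  let c′ , l≈c′r₀ = lincomb-point l l⊆r₀
  in c + c′ , λ k → trans (cong (c * rootVec r₀ k +_) (l≈c′r₀ k))
                          (sym (*-distribʳ-+ (rootVec r₀ k) c c′))

span-point : ∀ {r₀ : Root m n} {v} → Span (_≡ r₀) v → ∃ λ c → v ≈ᵥ (c ·ᵥ rootVec r₀)
span-point (l , l⊆r₀ , v≈l) =
  let c , l≈cr₀ = lincomb-point l l⊆r₀ in c , λ k → trans (v≈l k) (l≈cr₀ k)

VanishesAt : RootSet m n → Fin (m ℕ.+ n) → Set
VanishesAt S k = ∀ r → S r → rootVec r k ≡ 0ℚ

span-vanishes : ∀ {S : RootSet m n} {k} → VanishesAt S k → ∀ {v} → Span S v → v k ≡ 0ℚ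
span-vanishes {S = S} {k} S↓k (l , l⊆S , v≈l) = trans (v≈l k) (lincomb-vanishes l l⊆S)
  where
  lincomb-vanishes : ∀ l → All (λ p → S (proj₂ p)) l → lincomb l k ≡ 0ℚ
  lincomb-vanishes []             []           = refl
  lincomb-vanishes ((c , r) ∷ l) (r∈S ∷ l⊆S)
    rewrite S↓k r r∈S | lincomb-vanishes l l⊆S | *-zeroʳ c = refl

module _ {S : RootSet m n} where

  vanishes-row : ∀ {i} → (∀ i′ j′ → S (i′ , j′) → i′ ≢ i) → VanishesAt S (i ↑ˡ n)
  vanishes-row off (i′ , j′) r∈S = rootVec-row-other {j = j′} (off i′ j′ r∈S)

  vanishes-col : ∀ {j} → (∀ i′ j′ → S (i′ , j′) → j′ ≢ j) → VanishesAt S (m ↑ʳ j)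
  vanishes-col off (i′ , j′) r∈S = rootVec-col-other {i = i′} (off i′ j′ r∈S)

  row-occupied : ∀ i j → Span S (rootVec (i , j)) → ¬ (∀ i′ j′ → S (i′ , j′) → i′ ≢ i)
  row-occupied i j r∈span off =
    1ℚ≢0ℚ (trans (sym (rootVec-row-same {i = i} {j})) (span-vanishes (vanishes-row off) r∈span))

  col-occupied : ∀ i j → Span S (rootVec (i , j)) → ¬ (∀ i′ j′ → S (i′ , j′) → j′ ≢ j)
  col-occupied i j r∈span off =
    -1ℚ≢0ℚ (trans (sym (rootVec-col-same {i = i} {j})) (span-vanishes (vanishes-col off) r∈span))

Rect-complete : (A : Subset m) (B : Subset n) → Complete (Rect A B)
Rect-complete A B (i , j) = from-span , span-root (i , j)
  where
  from-span : Span (Rect A B) (rootVec (i , j)) → Rect A B (i , j)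
  from-span r∈span with i ∈? A | j ∈? B
  ... | yes i∈A | yes j∈B = i∈A , j∈B
  ... | no i∉A  | _       = contradiction (λ { _ _ (i∈A , _) refl → i∉A i∈A }) (row-occupied i j r∈span)
  ... | _       | no j∉B  = contradiction (λ { _ _ (_ , j∈B) refl → j∉B j∈B }) (col-occupied i j r∈span)

point-complete : (r₀ : Root m n) → Complete (_≡ r₀)
point-complete (i₀ , j₀) (i , j) = from-span , span-root (i , j)
  where
  from-span : Span (_≡ (i₀ , j₀)) (rootVec (i , j)) → (i , j) ≡ (i₀ , j₀)
  from-span r∈span with i F.≟ i₀ | j F.≟ j₀
  ... | yes refl | yes refl = refl
  ... | no i≢i₀  | _        = contradiction (λ { _ _ refl refl → i≢i₀ refl }) (row-occupied i j r∈span)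
  ... | _        | no j≢j₀  = contradiction (λ { _ _ refl refl → j≢j₀ refl }) (col-occupied i j r∈span)

point-irreducible : (r₀ : Root m n) → Irreducible (_≡ r₀)
point-irreducible r₀ =
  point-complete r₀ ,
  λ (S₁ , S₂ , split , disjoint , (r₁ , r₁∈S₁) , (r₂ , r₂∈S₂) , _) →
    disjoint r₀ (subst S₁ (proj₂ (split r₁) (inj₁ r₁∈S₁)) r₁∈S₁)
                (subst S₂ (proj₂ (split r₂) (inj₂ r₂∈S₂)) r₂∈S₂)

module _ {S₁ S₂ : RootSet m n} (independent : ∀ v → Span S₁ v → Span S₂ v → v ≈ᵥ 0ᵥ) where

  decomposition-unique : ∀ {u₁ u₂ w₁ w₂} → Span S₁ u₁ → Span S₂ u₂ → Span S₁ w₁ → Span S₂ w₂ →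
                         (u₁ +ᵥ u₂) ≈ᵥ (w₁ +ᵥ w₂) → u₁ ≈ᵥ w₁
  decomposition-unique {u₁} {u₂} {w₁} {w₂} u₁∈ u₂∈ w₁∈ w₂∈ u≈w k = begin
    u₁ k                         ≡⟨ solve 2 (λ x y → x := (x :+ con (- 1ℚ) :* y) :+ y) refl (u₁ k) (w₁ k) ⟩
    (u₁ k + - 1ℚ * w₁ k) + w₁ k  ≡⟨ cong (_+ w₁ k) (difference≈0 k) ⟩
    0ℚ + w₁ k                    ≡⟨ +-identityˡ (w₁ k) ⟩
    w₁ k                         ∎
    where
    open +-*-Solver
    open ≡-Reasoning
    same : (u₁ +ᵥ ((- 1ℚ) ·ᵥ w₁)) ≈ᵥ (w₂ +ᵥ ((- 1ℚ) ·ᵥ u₂))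
    same k = begin
      u₁ k + - 1ℚ * w₁ k                   ≡⟨ solve 3 (λ a b c → a :+ con (- 1ℚ) :* c
                                                              := (a :+ b) :+ con (- 1ℚ) :* (c :+ b))
                                                      refl (u₁ k) (u₂ k) (w₁ k) ⟩
      (u₁ k + u₂ k) + - 1ℚ * (w₁ k + u₂ k) ≡⟨ cong (_+ - 1ℚ * (w₁ k + u₂ k)) (u≈w k) ⟩
      (w₁ k + w₂ k) + - 1ℚ * (w₁ k + u₂ k) ≡⟨ solve 3 (λ a b c → (a :+ b) :+ con (- 1ℚ) :* (a :+ c)
                                                              := b :+ con (- 1ℚ) :* c)
                                                      refl (w₁ k) (w₂ k) (u₂ k) ⟩
      w₂ k + - 1ℚ * u₂ k                   ∎
    difference≈0 : (u₁ +ᵥ ((- 1ℚ) ·ᵥ w₁)) ≈ᵥ 0ᵥ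
    difference≈0 = independent _ (span-+ᵥ u₁∈ (span-·ᵥ (- 1ℚ) w₁∈))
                                 (span-resp same (span-+ᵥ w₂∈ (span-·ᵥ (- 1ℚ) u₂∈)))

  part₁ part₂ : ∀ r → S₁ r ⊎ S₂ r → Vect (m ℕ.+ n)
  part₁ r (inj₁ _) = rootVec r
  part₁ r (inj₂ _) = 0ᵥ
  part₂ r (inj₁ _) = 0ᵥ
  part₂ r (inj₂ _) = rootVec r

  part₁∈span : ∀ r s → Span S₁ (part₁ r s)
  part₁∈span r (inj₁ r∈S₁) = span-root r r∈S₁
  part₁∈span r (inj₂ _)    = span-0ᵥ

  part₂∈span : ∀ r s → Span S₂ (part₂ r s)
  part₂∈span r (inj₁ _)    = span-0ᵥ
  part₂∈span r (inj₂ r∈S₂) = span-root r r∈S₂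

  rootVec≈part₁+part₂ : ∀ r s → rootVec r ≈ᵥ (part₁ r s +ᵥ part₂ r s)
  rootVec≈part₁+part₂ r (inj₁ _) k = sym (+-identityʳ _)
  rootVec≈part₁+part₂ r (inj₂ _) k = sym (+-identityˡ _)

  part₁-vanishes : ∀ r s k → rootVec r k ≡ 0ℚ → part₁ r s k ≡ 0ℚ
  part₁-vanishes r (inj₁ _) k r↓k = r↓k
  part₁-vanishes r (inj₂ _) k _   = refl

  -- With y = y₁ + y₂ and w = w₁ + w₂ split along span S₁ ⊕ span S₂, uniqueness gives x + y₁ = w₁.
  exchange : ∀ {x y z w} → S₁ x → S₂ z → (y∈ : S₁ y ⊎ S₂ y) (w∈ : S₁ w ⊎ S₂ w) →
             (rootVec x +ᵥ rootVec y) ≈ᵥ (rootVec z +ᵥ rootVec w) →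
             ∀ k → rootVec y k ≡ 0ℚ → rootVec w k ≡ 0ℚ → rootVec x k ≡ 0ℚ
  exchange {x} {y} {z} {w} x∈S₁ z∈S₂ y∈ w∈ x+y≈z+w k y↓k w↓k = begin
    rootVec x k                  ≡⟨ sym (+-identityʳ _) ⟩
    rootVec x k + 0ℚ             ≡⟨ cong (rootVec x k +_) (sym (part₁-vanishes y y∈ k y↓k)) ⟩
    rootVec x k + part₁ y y∈ k   ≡⟨ decomposition-unique
                                      (span-+ᵥ (span-root x x∈S₁) (part₁∈span y y∈)) (part₂∈span y y∈)
                                      (part₁∈span w w∈) (span-+ᵥ (span-root z z∈S₂) (part₂∈span w w∈))
                                      regroup k ⟩
    part₁ w w∈ k                 ≡⟨ part₁-vanishes w w∈ k w↓k ⟩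
    0ℚ                           ∎
    where
    open ≡-Reasoning
    open +-*-Solver
    regroup : ((rootVec x +ᵥ part₁ y y∈) +ᵥ part₂ y y∈) ≈ᵥ (part₁ w w∈ +ᵥ (rootVec z +ᵥ part₂ w w∈))
    regroup k = begin
      (rootVec x k + part₁ y y∈ k) + part₂ y y∈ k ≡⟨ +-assoc (rootVec x k) (part₁ y y∈ k) (part₂ y y∈ k) ⟩
      rootVec x k + (part₁ y y∈ k + part₂ y y∈ k) ≡⟨ cong (rootVec x k +_) (sym (rootVec≈part₁+part₂ y y∈ k)) ⟩
      rootVec x k + rootVec y k                   ≡⟨ x+y≈z+w k ⟩
      rootVec z k + rootVec w k                   ≡⟨ cong (rootVec z k +_) (rootVec≈part₁+part₂ w w∈ k) ⟩
      rootVec z k + (part₁ w w∈ k + part₂ w w∈ k) ≡⟨ solve 3 (λ a b c → a :+ (b :+ c) := b :+ (a :+ c)) refl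
                                                         (rootVec z k) (part₁ w w∈ k) (part₂ w w∈ k) ⟩
      part₁ w w∈ k + (rootVec z k + part₂ w w∈ k) ∎

module _ {A : Subset m} {B : Subset n} (nondegenerate : ¬ Degenerate A B) {S₁ S₂ : RootSet m n}
         (split : ∀ r → Rect A B r ⇔' (S₁ r ⊎ S₂ r))
         (independent : ∀ v → Span S₁ v → Span S₂ v → v ≈ᵥ 0ᵥ) where

  private
    side : ∀ {r} → Rect A B r → S₁ r ⊎ S₂ r
    side = proj₁ (split _)

    inside₁ : ∀ {r} → S₁ r → Rect A B r
    inside₁ r∈S₁ = proj₂ (split _) (inj₁ r∈S₁)

    inside₂ : ∀ {r} → S₂ r → Rect A B r
    inside₂ r∈S₂ = proj₂ (split _) (inj₂ r∈S₂)

  row-not-split : ∀ {a c d} → S₁ (a , c) → S₂ (a , d) → ⊥′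
  row-not-split {a} {c} {d} ac∈S₁ ad∈S₂
    with a∈A , c∈B ← inside₁ ac∈S₁ | _ , d∈B ← inside₂ ad∈S₂
    with b , b∈A , a≢b ← ∣p∣≢1⇒another (nondegenerate ∘ inj₁) a∈A
    = 1ℚ≢0ℚ (trans (sym (rootVec-row-same {i = a} {c}))
                    (exchange independent ac∈S₁ ad∈S₂ (side (b∈A , d∈B)) (side (b∈A , c∈B))
                              (rootVec-square a b c d) (a ↑ˡ n)
                              (rootVec-row-other (a≢b ∘ sym)) (rootVec-row-other (a≢b ∘ sym))))

  col-not-split : ∀ {a b c} → S₁ (a , c) → S₂ (b , c) → ⊥′
  col-not-split {a} {b} {c} ac∈S₁ bc∈S₂
    with a∈A , c∈B ← inside₁ ac∈S₁ | b∈A , _ ← inside₂ bc∈S₂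
    with d , d∈B , c≢d ← ∣p∣≢1⇒another (nondegenerate ∘ inj₂) c∈B
    = -1ℚ≢0ℚ (trans (sym (rootVec-col-same {i = a} {c}))
                    (exchange independent ac∈S₁ bc∈S₂ (side (b∈A , d∈B)) (side (a∈A , d∈B))
                              (λ k → trans (rootVec-square a b c d k) (+-comm (rootVec (a , d) k) _)) (m ↑ʳ c)
                              (rootVec-col-other {i = b} (c≢d ∘ sym))
                              (rootVec-col-other {i = a} (c≢d ∘ sym))))

  -- The root (a₁|c₂) shares a row with the first root and a column with the second.
  not-split : ∀ {a₁ c₁ a₂ c₂} → S₁ (a₁ , c₁) → S₂ (a₂ , c₂) → ⊥′
  not-split a₁c₁∈S₁ a₂c₂∈S₂ with side (proj₁ (inside₁ a₁c₁∈S₁) , proj₂ (inside₂ a₂c₂∈S₂))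
  ... | inj₁ a₁c₂∈S₁ = col-not-split a₁c₂∈S₁ a₂c₂∈S₂
  ... | inj₂ a₁c₂∈S₂ = row-not-split a₁c₁∈S₁ a₁c₂∈S₂

Rect-irreducible : {A : Subset m} {B : Subset n} → ¬ Degenerate A B → Irreducible (Rect A B)
Rect-irreducible {A = A} {B} nondegenerate =
  Rect-complete A B ,
  λ (_ , _ , split , _ , (_ , r₁∈S₁) , (_ , r₂∈S₂) , _ , independent) →
    not-split nondegenerate split independent r₁∈S₁ r₂∈S₂

module _ {I : Set} {C : I → RootSet m n} where

  sumOver⇒span : ∀ {P : I → Set} {S : RootSet m n} → (∀ {s} → P s → ∀ r → C s r → S r) →
                 ∀ {v} → SumOver C P v → Span S v
  sumOver⇒span {P} {S} C⊆S v∈ = go _ v∈ refl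
    where
    -- Indexed by the list of summands, so that the recursion is structural.
    go : ∀ l {v} (v∈ : SumOver C P v) → proj₁ v∈ ≡ l → Span S v
    go []      ([] , [] , v≈0) refl = span-resp v≈0 span-0ᵥ
    go (_ ∷ l) (_ ∷ l , (Ps , w∈) ∷ l⊆ , v≈) refl =
      span-resp v≈ (span-+ᵥ (span-mono (C⊆S Ps) w∈) (go l (l , l⊆ , λ _ → refl) refl))

  lincomb⇒sumOver : ∀ {S : RootSet m n} → (∀ r → S r → ∃ λ s → C s r) →
                    ∀ l → All (λ p → S (proj₂ p)) l → SumOver C (λ _ → ⊤) (lincomb l)
  lincomb⇒sumOver S⊆⋃C []             []           = [] , [] , λ _ → refl
  lincomb⇒sumOver S⊆⋃C ((c , r) ∷ l) (r∈S ∷ l⊆S) =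
    let l′ , l′⊆ , l≈l′ = lincomb⇒sumOver S⊆⋃C l l⊆S
        s , r∈Cs = S⊆⋃C r r∈S
    in (s , c ·ᵥ rootVec r) ∷ l′ , (tt , span-·ᵥ c (span-root r r∈Cs)) ∷ l′⊆ ,
       λ k → cong (c * rootVec r k +_) (l≈l′ k)

  span⇒sumOver : ∀ {S : RootSet m n} → (∀ r → S r → ∃ λ s → C s r) →
                 ∀ {v} → Span S v → SumOver C (λ _ → ⊤) v
  span⇒sumOver S⊆⋃C (l , l⊆S , v≈l) =
    let l′ , l′⊆ , l≈l′ = lincomb⇒sumOver S⊆⋃C l l⊆S in l′ , l′⊆ , λ k → trans (v≈l k) (l≈l′ k)

  sumOver-vanishes : ∀ {P : I → Set} {k} → (∀ s → P s → VanishesAt (C s) k) →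
                     ∀ {v} → SumOver C P v → v k ≡ 0ℚ
  sumOver-vanishes {P} C↓k v∈ =
    span-vanishes {S = λ r → ∃ λ s → P s × C s r} (λ r (s , Ps , r∈Cs) → C↓k s Ps r r∈Cs)
                  (sumOver⇒span (λ Ps r r∈Cs → _ , Ps , r∈Cs) v∈)

  separated⇒independent : ∀ {t} → (∀ k → VanishesAt (C t) k ⊎ (∀ s → s ≢ t → VanishesAt (C s) k)) →
                          ∀ {v} → Span (C t) v → SumOver C (λ s → s ≢ t) v → v ≈ᵥ 0ᵥ
  separated⇒independent separated v∈Ct v∈others k with separated k
  ... | inj₁ Ct↓k     = span-vanishes Ct↓k v∈Ct
  ... | inj₂ others↓k = sumOver-vanishes others↓k v∈others

  point⇒independent : ∀ {t} {r₀ : Root m n} {k} → rootVec r₀ k * rootVec r₀ k ≡ 1ℚ →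
                      (∀ s → s ≢ t → VanishesAt (C s) k) →
                      ∀ {v} → Span (_≡ r₀) v → SumOver C (λ s → s ≢ t) v → v ≈ᵥ 0ᵥ
  point⇒independent {r₀ = r₀} {k} unit others↓k v∈r₀ v∈others k′
    with c , v≈cr₀ ← span-point v∈r₀
    with refl ← p*u≡0⇒p≡0 {p = c} unit (trans (sym (v≈cr₀ k)) (sumOver-vanishes others↓k v∈others))
    = trans (v≈cr₀ k′) (*-zeroˡ (rootVec r₀ k′))

module _ {A : Subset m} {B : Subset n} where

  inRectᵇ⇒Rect : ∀ r → inRectᵇ A B r ≡ true → Rect A B r
  inRectᵇ⇒Rect (i , j) i,j∈ᵇ with lookup A i in i∈ᵇ | lookup B j in j∈ᵇ | i,j∈ᵇ
  ... | true | true | _ = lookup⇒[]= i A i∈ᵇ , lookup⇒[]= j B j∈ᵇ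

  Rect⇒inRectᵇ : ∀ r → Rect A B r → inRectᵇ A B r ≡ true
  Rect⇒inRectᵇ _ (i∈A , j∈B) rewrite []=⇒lookup i∈A | []=⇒lookup j∈B = refl

module Decomposition {h} (A : Fin h → Subset m) (B : Fin h → Subset n)
                     (disjointA : ∀ i j → i ≢ j → A i ∩ A j ≡ ⊥)
                     (disjointB : ∀ i j → i ≢ j → B i ∩ B j ≡ ⊥) where
  open Family A B

  data Shape (i : Fin h) (C : RootSet m n) : Set₁ where
    rectangle : ¬ Degenerate (A i) (B i) → C ≡ Rect (A i) (B i) → Shape i C
    point     : ∀ r₀ → Degenerate (A i) (B i) → Rect (A i) (B i) r₀ → C ≡ (_≡ r₀) → Shape i C

  shape : ∀ t → Shape (proj₁ t) (Comp t)
  shape (i , x) = go (∣ A i ∣ ℕ.≟ 1) (∣ B i ∣ ℕ.≟ 1) x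
    where
    go : (dA : Dec (∣ A i ∣ ≡ 1)) (dB : Dec (∣ B i ∣ ≡ 1)) (x : IdxAt i (isYes dA ∨ isYes dB)) →
         Shape i (compAt i (isYes dA ∨ isYes dB) x)
    go (yes ∣A∣≡1) _           (r₀ , r₀∈ᵇ) = point r₀ (inj₁ ∣A∣≡1) (inRectᵇ⇒Rect r₀ r₀∈ᵇ) refl
    go (no _)      (yes ∣B∣≡1) (r₀ , r₀∈ᵇ) = point r₀ (inj₂ ∣B∣≡1) (inRectᵇ⇒Rect r₀ r₀∈ᵇ) refl
    go (no ∣A∣≢1)  (no ∣B∣≢1)  tt           = rectangle [ ∣A∣≢1 , ∣B∣≢1 ] refl

  Comp⊆Rect : ∀ t r → Comp t r → Rect (A (proj₁ t)) (B (proj₁ t)) r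
  Comp⊆Rect t r r∈t with shape t
  ... | rectangle _ C≡Rect    = subst (λ C → C r) C≡Rect r∈t
  ... | point r₀ _ r₀∈ C≡r₀   = subst (Rect _ _) (sym (subst (λ C → C r) C≡r₀ r∈t)) r₀∈

  row-owner : ∀ s {a b i} → Comp s (a , b) → a ∈ A i → proj₁ s ≡ i
  row-owner s r∈s a∈Ai = disjoint⇒index-unique disjointA (proj₁ (Comp⊆Rect s _ r∈s)) a∈Ai

  col-owner : ∀ s {a b i} → Comp s (a , b) → b ∈ B i → proj₁ s ≡ i
  col-owner s r∈s b∈Bi = disjoint⇒index-unique disjointB (proj₂ (Comp⊆Rect s _ r∈s)) b∈Bi

  Comp⊆Rect-of-row : ∀ s {a b i} → Comp s (a , b) → a ∈ A i → Rect (A i) (B i) (a , b)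
  Comp⊆Rect-of-row s r∈s a∈Ai with refl ← row-owner s r∈s a∈Ai = Comp⊆Rect s _ r∈s

  Comp⊆Rect-of-col : ∀ s {a b i} → Comp s (a , b) → b ∈ B i → Rect (A i) (B i) (a , b)
  Comp⊆Rect-of-col s r∈s b∈Bi with refl ← col-owner s r∈s b∈Bi = Comp⊆Rect s _ r∈s

  component-unique : ∀ s t r → Comp s r → Comp t r → s ≡ t
  component-unique (i , x) (j , y) r r∈s r∈t
    with refl ← row-owner (i , x) r∈s (proj₁ (Comp⊆Rect (j , y) r r∈t))
    = cong (i ,_) (same-index _ x y r∈s r∈t)
    where
    same-index : ∀ b (x y : IdxAt i b) → compAt i b x r → compAt i b y r → x ≡ y
    same-index true  (_ , p) (_ , q) refl refl = cong (r ,_) (Decidable⇒UIP.≡-irrelevant _≟ᵇ_ p q)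
    same-index false tt      tt      _    _    = refl

  Comp⊆Union : ∀ t r → Comp t r → Union r
  Comp⊆Union t r r∈t = proj₁ t , Comp⊆Rect t r r∈t

  Union⊆Comp : ∀ r → Union r → ∃ λ t → Comp t r
  Union⊆Comp r (i , r∈Rect) = let x , r∈x = index (isDeg (A i) (B i)) in (i , x) , r∈x
    where
    index : ∀ b → Σ (IdxAt i b) λ x → compAt i b x r
    index true  = (r , Rect⇒inRectᵇ r r∈Rect) , refl
    index false = tt , r∈Rect

  component-nonempty : (∀ i → Nonempty (A i)) → (∀ i → Nonempty (B i)) → ∀ t → ∃ (Comp t)
  component-nonempty nonemptyA nonemptyB t with shape t
  ... | rectangle _ C≡Rect  = let a , a∈A = nonemptyA (proj₁ t); b , b∈B = nonemptyB (proj₁ t)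
                              in (a , b) , subst (λ C → C (a , b)) (sym C≡Rect) (a∈A , b∈B)
  ... | point r₀ _ _ C≡r₀   = r₀ , subst (λ C → C r₀) (sym C≡r₀) refl

  component-irreducible : ∀ t → Irreducible (Comp t)
  component-irreducible t with shape t
  ... | rectangle nondegenerate C≡Rect = subst Irreducible (sym C≡Rect) (Rect-irreducible nondegenerate)
  ... | point r₀ _ _ C≡r₀              = subst Irreducible (sym C≡r₀) (point-irreducible r₀)

  module _ {t} (C≡Rect : Comp t ≡ Rect (A (proj₁ t)) (B (proj₁ t))) where

    private
      into : ∀ {r} → Rect (A (proj₁ t)) (B (proj₁ t)) r → Comp t r
      into {r} = subst (λ C → C r) (sym C≡Rect)

    rectangle-separated : ∀ k → VanishesAt (Comp t) k ⊎ (∀ s → s ≢ t → VanishesAt (Comp s) k)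
    rectangle-separated k with coordinate {m} {n} k
    ... | row a with a ∈? A (proj₁ t)
    ...   | yes a∈A = inj₂ λ s s≢t → vanishes-row λ { _ _ r∈s refl →
                        s≢t (component-unique s t _ r∈s (into (Comp⊆Rect-of-row s r∈s a∈A))) }
    ...   | no a∉A  = inj₁ (vanishes-row λ { _ _ r∈t refl → a∉A (proj₁ (Comp⊆Rect t _ r∈t)) })
    rectangle-separated k | col b with b ∈? B (proj₁ t)
    ...   | yes b∈B = inj₂ λ s s≢t → vanishes-col λ { _ _ r∈s refl →
                        s≢t (component-unique s t _ r∈s (into (Comp⊆Rect-of-col s r∈s b∈B))) }
    ...   | no b∉B  = inj₁ (vanishes-col λ { _ _ r∈t refl → b∉B (proj₂ (Comp⊆Rect t _ r∈t)) })

  module _ {t a₀ b₀} (C≡r₀ : Comp t ≡ (_≡ (a₀ , b₀)))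
           (a₀∈A : a₀ ∈ A (proj₁ t)) (b₀∈B : b₀ ∈ B (proj₁ t)) where

    private
      into : ∀ {r} → r ≡ (a₀ , b₀) → Comp t r
      into {r} = subst (λ C → C r) (sym C≡r₀)

    single-row⇒col-private : ∣ A (proj₁ t) ∣ ≡ 1 → ∀ s → s ≢ t → VanishesAt (Comp s) (m ↑ʳ b₀)
    single-row⇒col-private ∣A∣≡1 s s≢t = vanishes-col λ { _ _ r∈s refl →
      s≢t (component-unique s t _ r∈s
             (into (cong (_, b₀) (∣p∣≡1⇒unique ∣A∣≡1 (proj₁ (Comp⊆Rect-of-col s r∈s b₀∈B)) a₀∈A)))) }

    single-col⇒row-private : ∣ B (proj₁ t) ∣ ≡ 1 → ∀ s → s ≢ t → VanishesAt (Comp s) (a₀ ↑ˡ n)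
    single-col⇒row-private ∣B∣≡1 s s≢t = vanishes-row λ { _ _ r∈s refl →
      s≢t (component-unique s t _ r∈s
             (into (cong (a₀ ,_) (∣p∣≡1⇒unique ∣B∣≡1 (proj₂ (Comp⊆Rect-of-row s r∈s a₀∈A)) b₀∈B)))) }

  components-independent : ∀ t v → Span (Comp t) v → SumOver Comp (λ s → s ≢ t) v → v ≈ᵥ 0ᵥ
  components-independent t v v∈t v∈others with shape t
  ... | rectangle _ C≡Rect = separated⇒independent (rectangle-separated C≡Rect) v∈t v∈others
  ... | point (a₀ , b₀) (inj₁ ∣A∣≡1) (a₀∈A , b₀∈B) C≡r₀ =
    point⇒independent (cong (λ x → x * x) (rootVec-col-same {i = a₀} {b₀}))
                      (single-row⇒col-private C≡r₀ a₀∈A b₀∈B ∣A∣≡1)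
                      (subst (λ C → Span C v) C≡r₀ v∈t) v∈others
  ... | point (a₀ , b₀) (inj₂ ∣B∣≡1) (a₀∈A , b₀∈B) C≡r₀ =
    point⇒independent (cong (λ x → x * x) (rootVec-row-same {i = a₀} {b₀}))
                      (single-col⇒row-private C≡r₀ a₀∈A b₀∈B ∣B∣≡1)
                      (subst (λ C → Span C v) C≡r₀ v∈t) v∈others

mainTheorem10 :
    (∀ (m n : ℕ) → 1 ≤ m → 1 ≤ n → (A : Subset m) (B : Subset n) →
       Nonempty A → Nonempty B → ¬ Degenerate A B → Irreducible (Rect A B))
    ×
    (∀ (m n h : ℕ) → 1 ≤ m → 1 ≤ n → (A : Fin h → Subset m) (B : Fin h → Subset n) →
       (∀ i → Nonempty (A i)) → (∀ i → Nonempty (B i)) →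
       (∀ i j → i ≢ j → A i ∩ A j ≡ ⊥) → (∀ i j → i ≢ j → B i ∩ B j ≡ ⊥) →
       IsIrreducibleDecomposition (Family.CompIdx A B) (Family.Comp A B) (Family.Union A B))
mainTheorem10 =
  (λ _ _ _ _ _ _ _ _ → Rect-irreducible) ,
  λ _ _ _ _ _ A B nonemptyA nonemptyB disjointA disjointB →
    let open Decomposition A B disjointA disjointB
        open Family A B
    in component-nonempty nonemptyA nonemptyB ,
       Comp⊆Union ,
       Union⊆Comp ,
       component-unique ,
       component-irreducible ,
       (λ _ → span⇒sumOver Union⊆Comp , sumOver⇒span (λ {s} _ → Comp⊆Union s)) ,
       components-independent
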